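{- For every $n\ge1$ and every $e\in\mathbf{I}_n(021)$, the number of ascents of $e$ equals the number of black nodes of $\tau(e)$.
   Context: An inversion sequence of length $n$ is an integer sequence $e=(e_1,\ldots,e_n)$ with $0 \le e_i < i$ for all $i$; $\mathbf{I}_n(021)$ is the set of those with no $i<j<k$ such that $e_i<e_k<e_j$. An ascent of $e$ is an index $i$ with $e_i<e_{i+1}$. $\mathcal{T}_m$ is the set of rooted binary trees on $m$ nodes (left and right children distinguished), each node colored black or white, such that no node has the same color as its right child; $\mathcal{T}_0$ is the empty tree. For trees $T,S$, $\omega(T,S)$ (resp. $\beta(T,S)$) is the tree with a white (resp. black) root whose left subtree is $T$ and right subtree is $S$. For an integer $t$ and a sequence $(f_1,\ldots,f_m)$, $\sigma_t(f_1,\ldots,f_m)$ is obtained by adding $t$ to every nonzero entry and leaving zeros unchanged; $0^\ell$ denotes $\ell$ zeros and juxtaposition with $\cdot$ denotes concatenation. The map $\tau:\mathbf{I}_n(021)\to\mathcal{T}_{n-1}$ is defined recursively: $\tau((0))$ is the empty tree. For $n\ge2$, let $\ell\ge1$ be the largest integer with $e_2=e_3=\cdots=e_{\ell+1}$; let $k+1$ be the smallest position $k+1>\ell+1$ with $e_{k+1}\ge k-\ell+1$, and $k=n$ if there is no such position. Then $\tau(e)=\omega\big(\tau(0^\ell\cdot\sigma_{\ell-k}(e_{k+1},\ldots,e_n)),\ \tau(0,e_{\ell+2},\ldots,e_k)\big)$ if $e_2=0$, and $\tau(e)=\beta\big(\tau(0^\ell\cdot\sigma_{\ell-k}(e_{k+1},\ldots,e_n)),\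 \tau(0,e_{\ell+2},\ldots,e_k)\big)$ if $e_2=1$. (Both arguments are again 021-avoiding inversion sequences, and $\tau$ is a bijection onto $\mathcal{T}_{n-1}$.) -}

module Defs where

open import Data.Nat using (ℕ; zero; suc; _+_; _∸_; _≤_; _<_; _≟_; _<?_)
open import Data.Bool using (Bool; true; false; if_then_else_)
open import Data.List using (List; []; _∷_; length; replicate; map; _++_; takeWhile; dropWhile)
open import Data.Product using (_×_; _,_)
open import Data.Vec using (Vec; lookup)
open import Data.Fin using (Fin; toℕ)
import Data.Fin as F
open import Relation.Nullary using (¬_; does)

-- Inversion sequences of length n, stored 0-indexed: entry i (0-based)
-- is e_{i+1}, and the condition 0 ≤ e_{i+1} < i+1 reads  e[i] ≤ i.
IsInvSeq : ∀ {n} → Vec ℕ n → Set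
IsInvSeq {n} e = ∀ (i : Fin n) → lookup e i ≤ toℕ i

Avoids021 : ∀ {n} → Vec ℕ n → Set
Avoids021 {n} e = ∀ (i j k : Fin n) → i F.< j → j F.< k →
  ¬ (lookup e i < lookup e k × lookup e k < lookup e j)

ascents : List ℕ → ℕ
ascents [] = 0
ascents (x ∷ []) = 0
ascents (x ∷ y ∷ xs) = (if does (x <? y) then 1 else 0) + ascents (y ∷ xs)

data Color : Set where
  white black : Color

data Tree : Set where
  empty : Tree
  node  : Color → Tree → Tree → Tree

ω β : Tree → Tree → Tree
ω T S = node white T S
β T S = node black T S

blackNodes : Tree → ℕ
blackNodes empty = 0
blackNodes (node white l r) = blackNodes l + blackNodes r
blackNodes (node black l r) = suc (blackNodes l + blackNodes r)

σneg : ℕ → List ℕ → List ℕ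
σneg t = map (λ { zero → zero ; (suc x) → suc x ∸ t })

-- splitFrom j xs: xs lists e_{ℓ+2}, e_{ℓ+3}, ... where the entry at offset j
-- sits at position ℓ+2+j = k+1 with k = ℓ+1+j; the split point is the first
-- entry with e_{k+1} ≥ k-ℓ+1 = j+2.  Returns (e_{ℓ+2..k}, e_{k+1..n}).
splitFrom : ℕ → List ℕ → List ℕ × List ℕ
splitFrom j [] = [] , []
splitFrom j (x ∷ xs) with does (suc (suc j) Data.Nat.≤? x)
... | true  = [] , x ∷ xs
... | false with splitFrom (suc j) xs
...   | (p , s) = x ∷ p , s

-- τ with fuel; τ e := τ' (length e) e.  Every recursive call is on a strictly
-- shorter list, so fuel = length is always sufficient.
τ' : ℕ → List ℕ → Tree
τ' zero _ = empty
τ' (suc f) [] = empty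
τ' (suc f) (e₁ ∷ []) = empty
τ' (suc f) (e₁ ∷ e₂ ∷ xs) with splitFrom 0 (dropWhile (λ x → x ≟ e₂) (e₂ ∷ xs))
... | (pre , suf) = col e₂
        (τ' f (replicate ℓ 0 ++ σneg (suc (length pre)) suf))
        (τ' f (0 ∷ pre))
  where
  ℓ : ℕ
  ℓ = length (takeWhile (λ x → x ≟ e₂) (e₂ ∷ xs))
  col : ℕ → Tree → Tree → Tree
  col zero = ω
  col (suc _) = β

τ : List ℕ → Tree
τ e = τ' (length e) e

module Submission where

-- Every e ∈ I_n(021) starts with e₁ = 0, so avoiding 021 forces every later
-- positive entry to be at least every earlier entry ("upward pairs").  We
-- prove, by induction on the fuel of τ', the statement for all lists that
-- are inversion sequences with upward pairs; both invariants are preserved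
-- by the two recursive arguments of τ.
--
-- For the inductive step write e = 0 · c^(1+ℓ) · pre · suf, where c = e₂ ∈ {0,1},
-- c^(1+ℓ) is the maximal run of c, and suf starts at position k+1.  Then
--   * the run contributes the ascent [0 < c], i.e. exactly the colour of the root;
--   * the first entry of pre is not above c (it is ≤ 1 and differs from c),
--     so pre contributes the ascents of 0 · pre, the right argument of τ;
--   * the first entry of suf exceeds everything before it, and σ shifts the
--     entries of suf (all 0 or large) without changing their relative order,
--     so suf contributes the ascents of 0^(1+ℓ) · σ(suf), the left argument of τ.

open import Defs
open import Data.Nat using (ℕ; zero; suc; _+_; _∸_; _≤_; _<_; _≟_; _<?_; _≤?_; z≤n; s≤s)
open import Data.Nat.Properties
open import Data.Bool using (if_then_else_)
open import Data.List using (List; []; _∷_; length; replicate; map; _++_; takeWhile; dropWhile; head)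
open import Data.List.Properties using (length-++; length-map; takeWhile++dropWhile)
open import Data.List.Relation.Unary.All as All using (All; []; _∷_)
open import Data.List.Relation.Unary.All.Properties as AllP using (all-head-dropWhile)
open import Data.List.Relation.Unary.AllPairs as AllPairs using (AllPairs; []; _∷_)
import Data.List.Relation.Unary.AllPairs.Properties as AllPairsP
open import Data.Maybe.Relation.Unary.All as Maybe using (just; nothing)
open import Data.Product using (_×_; _,_; proj₁; proj₂)
open import Data.Sum using (_⊎_; inj₁; inj₂)
open import Data.Unit using (⊤; tt)
open import Data.Empty using (⊥-elim)
open import Data.Vec using (Vec; toList; lookup) renaming (_∷_ to _∷ᵥ_; [] to []ᵥ)
import Data.Vec.Relation.Unary.All.Properties as VecAll
open import Data.Fin using (toℕ) renaming (zero to fzero; suc to fsuc)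
import Data.Fin as F
open import Function using (_∘_)
open import Level using (0ℓ)
open import Relation.Binary using (Rel)
open import Relation.Nullary using (¬_; Dec; yes; no; does)
open import Relation.Nullary.Decidable using (dec-true; dec-false)
open import Relation.Unary using (Pred; Decidable)
open import Relation.Binary.PropositionalEquality

ascentAt : ℕ → ℕ → ℕ
ascentAt x y = if does (x <? y) then 1 else 0

ascFrom : ℕ → List ℕ → ℕ
ascFrom p ys = ascents (p ∷ ys)

ascentAt-< : ∀ {x y} → x < y → ascentAt x y ≡ 1
ascentAt-< {x} {y} x<y rewrite dec-true (x <? y) x<y = refl

ascentAt-≥ : ∀ {x y} → y ≤ x → ascentAt x y ≡ 0
ascentAt-≥ {x} {y} y≤x rewrite dec-false (x <? y) (≤⇒≯ y≤x) = refl

ascentAt-cong : ∀ {x y x′ y′} → (x < y → x′ < y′) → (y ≤ x → y′ ≤ x′) →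
  ascentAt x y ≡ ascentAt x′ y′
ascentAt-cong {x} {y} {x′} {y′} lt ge = byCases (x <? y)
  where
  byCases : Dec (x < y) → ascentAt x y ≡ ascentAt x′ y′
  byCases (yes x<y) = trans (ascentAt-< x<y) (sym (ascentAt-< (lt x<y)))
  byCases (no x≮y)  = trans (ascentAt-≥ (≮⇒≥ x≮y)) (sym (ascentAt-≥ (ge (≮⇒≥ x≮y))))

lastFrom : ℕ → List ℕ → ℕ
lastFrom p []       = p
lastFrom p (x ∷ xs) = lastFrom x xs

ascFrom-++ : ∀ p xs ys → ascFrom p (xs ++ ys) ≡ ascFrom p xs + ascFrom (lastFrom p xs) ys
ascFrom-++ p []       ys = refl
ascFrom-++ p (x ∷ xs) ys =
  trans (cong (ascentAt p x +_) (ascFrom-++ x xs ys)) (sym (+-assoc (ascentAt p x) _ _))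

ascFrom-run : ∀ c n ys → ascFrom c (replicate n c ++ ys) ≡ ascFrom c ys
ascFrom-run c zero    ys = refl
ascFrom-run c (suc n) ys = cong₂ _+_ (ascentAt-≥ {c} ≤-refl) (ascFrom-run c n ys)

ascFrom-map : ∀ {P : Pred ℕ 0ℓ} (f : ℕ → ℕ) →
  (∀ {x y} → P x → P y → ascentAt x y ≡ ascentAt (f x) (f y)) →
  ∀ {p} ys → P p → All P ys → ascFrom p ys ≡ ascFrom (f p) (map f ys)
ascFrom-map f resp []       _  []          = refl
ascFrom-map f resp (y ∷ ys) Pp (Py ∷ Pys) = cong₂ _+_ (resp Pp Py) (ascFrom-map f resp ys Py Pys)

ZeroOr : Pred ℕ 0ℓ → Pred ℕ 0ℓ
ZeroOr P y = y ≡ 0 ⊎ P y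

lower : ℕ → ℕ → ℕ
lower t zero    = zero
lower t (suc x) = suc x ∸ t

σneg-lower : ∀ t xs → σneg t xs ≡ map (lower t) xs
σneg-lower t []           = refl
σneg-lower t (zero  ∷ xs) = cong (0 ∷_) (σneg-lower t xs)
σneg-lower t (suc x ∷ xs) = cong (suc x ∸ t ∷_) (σneg-lower t xs)

lower-positive : ∀ {t s} → t < s → 0 < lower t s
lower-positive {s = suc s} t<s = m<n⇒0<n∸m t<s

lower-ascentAt : ∀ t {x y} → ZeroOr (t <_) x → ZeroOr (t <_) y →
  ascentAt x y ≡ ascentAt (lower t x) (lower t y)
lower-ascentAt t {zero}  {zero}  _          _          = refl
lower-ascentAt t {zero}  {suc y} _          (inj₁ ())
lower-ascentAt t {zero}  {suc y} _          (inj₂ t<y) =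
  trans (ascentAt-< {0} {suc y} (s≤s z≤n)) (sym (ascentAt-< (lower-positive t<y)))
lower-ascentAt t {suc x} {zero}  _          _          =
  trans (ascentAt-≥ {suc x} z≤n) (sym (ascentAt-≥ {lower t (suc x)} z≤n))
lower-ascentAt t {suc x} {suc y} (inj₁ ())  _
lower-ascentAt t {suc x} {suc y} (inj₂ _)   (inj₁ ())
lower-ascentAt t {suc x} {suc y} (inj₂ t<x) (inj₂ _)   =
  ascentAt-cong (λ x<y → ∸-monoˡ-< x<y (<⇒≤ t<x)) (∸-monoˡ-≤ t)

Upward : Rel ℕ 0ℓ
Upward x = ZeroOr (x ≤_)

UpwardPairs : List ℕ → Set
UpwardPairs = AllPairs Upward

upward-from-0 : ∀ y → Upward 0 y
upward-from-0 _ = inj₂ z≤n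

upward-above : ∀ {t s y} → t < s → Upward s y → ZeroOr (t <_) y
upward-above t<s (inj₁ y≡0) = inj₁ y≡0
upward-above t<s (inj₂ s≤y) = inj₂ (<-≤-trans t<s s≤y)

lower-upward : ∀ t {x y} → Upward x y → Upward (lower t x) (lower t y)
lower-upward t {x}     {zero}  _          = inj₁ refl
lower-upward t {x}     {suc y} (inj₁ ())
lower-upward t {zero}  {suc y} (inj₂ _)   = inj₂ z≤n
lower-upward t {suc x} {suc y} (inj₂ x≤y) = inj₂ (∸-monoˡ-≤ t x≤y)

-- If s exceeds both the preceding entry p and t, and everything after s is
-- upward from s, then p · s · ss and 0 · σ_{-t}(s · ss) have equally many
-- ascents: both begin with an ascent, and lowering keeps the order of the rest.
ascFrom-lower : ∀ {p t} s ss → p < s → t < s → All (Upward s) ss →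
  ascFrom p (s ∷ ss) ≡ ascFrom 0 (map (lower t) (s ∷ ss))
ascFrom-lower {t = t} s ss p<s t<s up =
  cong₂ _+_ (trans (ascentAt-< p<s) (sym (ascentAt-< (lower-positive t<s))))
            (ascFrom-map (lower t) (lower-ascentAt t) ss (inj₂ t<s) (All.map (upward-above t<s) up))

AllPairs-++⁻ˡ : ∀ {A : Set} {R : Rel A 0ℓ} xs {ys} → AllPairs R (xs ++ ys) → AllPairs R xs
AllPairs-++⁻ˡ []       _          = []
AllPairs-++⁻ˡ (x ∷ xs) (rx ∷ rxs) = AllP.++⁻ˡ xs rx ∷ AllPairs-++⁻ˡ xs rxs

AllPairs-++⁻ʳ : ∀ {A : Set} {R : Rel A 0ℓ} xs {ys} → AllPairs R (xs ++ ys) → AllPairs R ys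
AllPairs-++⁻ʳ []       rys       = rys
AllPairs-++⁻ʳ (x ∷ xs) (_ ∷ rxs) = AllPairs-++⁻ʳ xs rxs

-- Bounded i xs: the entry at offset j of xs is at most i + j.
-- Inversion sequences are exactly the lists with Bounded 0.
Bounded : ℕ → List ℕ → Set
Bounded i []       = ⊤
Bounded i (x ∷ xs) = x ≤ i × Bounded (suc i) xs

Bounded-++ʳ : ∀ i xs {ys} → Bounded i (xs ++ ys) → Bounded (length xs + i) ys
Bounded-++ʳ i []       b       = b
Bounded-++ʳ i (x ∷ xs) {ys} (_ , b) =
  subst (λ k → Bounded k ys) (+-suc (length xs) i) (Bounded-++ʳ (suc i) xs b)

Bounded-lower : ∀ t i ys → Bounded (t + i) ys → Bounded i (map (lower t) ys)
Bounded-lower t i []           _       = tt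
Bounded-lower t i (zero  ∷ ys) (_ , b) =
  z≤n , Bounded-lower t (suc i) ys (subst (λ k → Bounded k ys) (sym (+-suc t i)) b)
Bounded-lower t i (suc y ∷ ys) (y≤ , b) =
  m≤n+o⇒m∸n≤o (suc y) t y≤ , Bounded-lower t (suc i) ys (subst (λ k → Bounded k ys) (sym (+-suc t i)) b)

lastFrom-bound : ∀ {i c} xs → c ≤ i → Bounded i xs → lastFrom c xs ≤ length xs + i
lastFrom-bound []            c≤i _        = c≤i
lastFrom-bound {i} (x ∷ xs) _   (x≤i , b) =
  subst (lastFrom x xs ≤_) (+-suc (length xs) i) (lastFrom-bound xs (m≤n⇒m≤1+n x≤i) b)

module _ {A : Set} {P : Pred A 0ℓ} (P? : Decidable P) where

  takeWhile-All : ∀ xs → All P (takeWhile P? xs)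
  takeWhile-All []       = []
  takeWhile-All (x ∷ xs) with P? x
  ... | yes px = px ∷ takeWhile-All xs
  ... | no _   = []

  takeWhile-accept : ∀ {x} xs → P x → takeWhile P? (x ∷ xs) ≡ x ∷ takeWhile P? xs
  takeWhile-accept {x} xs px rewrite dec-true (P? x) px = refl

All-≡-replicate : ∀ {A : Set} {c : A} xs → All (_≡ c) xs → xs ≡ replicate (length xs) c
All-≡-replicate []       []             = refl
All-≡-replicate (x ∷ xs) (refl ∷ x≡cs) = cong (x ∷_) (All-≡-replicate xs x≡cs)

-- For e = x · c · xs, τ splits c · xs into a run of c of length 1 + runTail c xs
-- followed by rest c xs, which splitFrom cuts into front c xs and back c xs.
runTail : ℕ → List ℕ → ℕ
runTail c xs = length (takeWhile (_≟ c) xs)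

rest : ℕ → List ℕ → List ℕ
rest c xs = dropWhile (_≟ c) (c ∷ xs)

front back : ℕ → List ℕ → List ℕ
front c xs = proj₁ (splitFrom 0 (rest c xs))
back  c xs = proj₂ (splitFrom 0 (rest c xs))

run-decomposition : ∀ c xs → c ∷ xs ≡ replicate (suc (runTail c xs)) c ++ rest c xs
run-decomposition c xs = begin
    c ∷ xs
  ≡⟨ sym (takeWhile++dropWhile (_≟ c) (c ∷ xs)) ⟩
    takeWhile (_≟ c) (c ∷ xs) ++ rest c xs
  ≡⟨ cong (_++ rest c xs) (All-≡-replicate _ (takeWhile-All (_≟ c) (c ∷ xs))) ⟩
    replicate (length (takeWhile (_≟ c) (c ∷ xs))) c ++ rest c xs
  ≡⟨ cong (λ ys → replicate (length ys) c ++ rest c xs) (takeWhile-accept (_≟ c) xs refl) ⟩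
    replicate (suc (runTail c xs)) c ++ rest c xs
  ∎
  where open ≡-Reasoning

splitFrom-stop : ∀ {j x} xs → suc j < x → splitFrom j (x ∷ xs) ≡ ([] , x ∷ xs)
splitFrom-stop {j} {x} xs j<x rewrite dec-true (suc (suc j) ≤? x) j<x = refl

splitFrom-go : ∀ {j x} xs → x ≤ suc j →
  splitFrom j (x ∷ xs) ≡ (x ∷ proj₁ (splitFrom (suc j) xs) , proj₂ (splitFrom (suc j) xs))
splitFrom-go {j} {x} xs x≤j rewrite dec-false (suc (suc j) ≤? x) (≤⇒≯ x≤j) = refl

splitFrom-++ : ∀ j xs → proj₁ (splitFrom j xs) ++ proj₂ (splitFrom j xs) ≡ xs
splitFrom-++ j []       = refl
splitFrom-++ j (x ∷ xs) with suc j <? x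
... | yes j<x rewrite splitFrom-stop xs j<x = refl
... | no j≮x  rewrite splitFrom-go xs (≮⇒≥ j≮x) = cong (x ∷_) (splitFrom-++ (suc j) xs)

splitFrom-front : ∀ j xs → Bounded (suc j) (proj₁ (splitFrom j xs))
splitFrom-front j []       = tt
splitFrom-front j (x ∷ xs) with suc j <? x
... | yes j<x rewrite splitFrom-stop xs j<x = tt
... | no j≮x  rewrite splitFrom-go xs (≮⇒≥ j≮x) = ≮⇒≥ j≮x , splitFrom-front (suc j) xs

splitFrom-back : ∀ j xs →
  Maybe.All (length (proj₁ (splitFrom j xs)) + suc j <_) (head (proj₂ (splitFrom j xs)))
splitFrom-back j []       = nothing
splitFrom-back j (x ∷ xs) with suc j <? x
... | yes j<x rewrite splitFrom-stop xs j<x = just j<x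
... | no j≮x  rewrite splitFrom-go xs (≮⇒≥ j≮x) =
  subst (λ k → Maybe.All (k <_) (head (proj₂ (splitFrom (suc j) xs))))
        (+-suc (length (proj₁ (splitFrom (suc j) xs))) (suc j)) (splitFrom-back (suc j) xs)

-- After a run of c ∈ {0,1}, the next entry y ≤ 1 differs from c; so y is not
-- above c and compares with c as it compares with 0.
run-boundary : ∀ {c y} → c ≤ 1 → y ≤ 1 → y ≢ c → ascentAt c y ≡ ascentAt 0 y
run-boundary {zero}                        _        _        _   = refl
run-boundary {suc zero}    {zero}         _        _        _   =
  trans (ascentAt-≥ {1} z≤n) (sym (ascentAt-≥ {0} z≤n))
run-boundary {suc zero}    {suc zero}     _        _        1≢1 = ⊥-elim (1≢1 refl)
run-boundary {suc zero}    {suc (suc _)}  _        (s≤s ()) _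
run-boundary {suc (suc _)}                (s≤s ()) _        _

ascFrom-front : ∀ {c} pre {suf} → c ≤ 1 → Maybe.All (_≢ c) (head (pre ++ suf)) → Bounded 1 pre →
  ascFrom c pre ≡ ascFrom 0 pre
ascFrom-front []       _   _          _         = refl
ascFrom-front (y ∷ ys) c≤1 (just y≢c) (y≤1 , _) = cong (_+ ascFrom y ys) (run-boundary c≤1 y≤1 y≢c)

ascFrom-back : ∀ {c} pre suf → c ≤ 1 → Bounded 1 pre → Maybe.All (length pre + 1 <_) (head suf) →
  UpwardPairs suf → ascFrom (lastFrom c pre) suf ≡ ascFrom 0 (map (lower (suc (length pre))) suf)
ascFrom-back pre []       _   _    _          _        = refl
ascFrom-back pre (s ∷ ss) c≤1 bpre (just cut) (up ∷ _) =
  ascFrom-lower s ss (≤-<-trans (lastFrom-bound pre c≤1 bpre) cut)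
                     (subst (_< s) (+-comm (length pre) 1) cut) up

ascents-split : ∀ {c} ℓ pre suf → c ≤ 1 → Maybe.All (_≢ c) (head (pre ++ suf)) → Bounded 1 pre →
  Maybe.All (length pre + 1 <_) (head suf) → UpwardPairs suf →
  ascents (0 ∷ replicate (suc ℓ) c ++ pre ++ suf) ≡
    ascentAt 0 c + (ascents (replicate (suc ℓ) 0 ++ map (lower (suc (length pre))) suf) + ascents (0 ∷ pre))
ascents-split {c} ℓ pre suf c≤1 boundary bpre cut up = begin
    ascentAt 0 c + ascFrom c (replicate ℓ c ++ pre ++ suf)
  ≡⟨ cong (ascentAt 0 c +_) (trans (ascFrom-run c ℓ (pre ++ suf)) (ascFrom-++ c pre suf)) ⟩
    ascentAt 0 c + (ascFrom c pre + ascFrom (lastFrom c pre) suf)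
  ≡⟨ cong (ascentAt 0 c +_) (cong₂ _+_ (ascFrom-front pre c≤1 boundary bpre)
                                        (ascFrom-back pre suf c≤1 bpre cut up)) ⟩
    ascentAt 0 c + (ascFrom 0 pre + ascFrom 0 lowered)
  ≡⟨ cong (ascentAt 0 c +_) (+-comm (ascFrom 0 pre) _) ⟩
    ascentAt 0 c + (ascFrom 0 lowered + ascFrom 0 pre)
  ≡⟨ cong (λ a → ascentAt 0 c + (a + ascFrom 0 pre)) (sym (ascFrom-run 0 ℓ lowered)) ⟩
    ascentAt 0 c + (ascents (replicate (suc ℓ) 0 ++ lowered) + ascents (0 ∷ pre))
  ∎
  where
  open ≡-Reasoning
  lowered : List ℕ
  lowered = map (lower (suc (length pre))) suf

record Valid (f : ℕ) (e : List ℕ) : Set where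
  constructor valid
  field
    short   : length e ≤ f
    bounded : Bounded 0 e
    upward  : UpwardPairs e

-- Lowering suf by t = 1 + |pre| absorbs the offset of pre: the left
-- argument 0^n · σ(suf) is again an inversion sequence.
Bounded-left : ∀ n {c} i pre suf → Bounded (suc i) (replicate n c ++ pre ++ suf) →
  Bounded i (replicate n 0 ++ map (lower (suc (length pre))) suf)
Bounded-left zero    i pre suf b       =
  Bounded-lower (suc (length pre)) i suf
    (subst (λ k → Bounded k suf) (+-suc (length pre) i) (Bounded-++ʳ (suc i) pre b))
Bounded-left (suc n) i pre suf (_ , b) = z≤n , Bounded-left n (suc i) pre suf b

UpwardPairs-left : ∀ n t {suf} → UpwardPairs suf → UpwardPairs (replicate n 0 ++ map (lower t) suf)
UpwardPairs-left zero    t up = AllPairsP.map⁺ (AllPairs.map (lower-upward t) up)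
UpwardPairs-left (suc n) t up = All.universal upward-from-0 _ ∷ UpwardPairs-left n t up

shorter-left : ∀ n c t pre suf →
  length (replicate n 0 ++ map (lower t) suf) ≤ length (replicate n c ++ pre ++ suf)
shorter-left zero    c t pre suf = begin
    length (map (lower t) suf) ≡⟨ length-map (lower t) suf ⟩
    length suf                 ≤⟨ m≤n+m (length suf) (length pre) ⟩
    length pre + length suf    ≡⟨ length-++ pre ⟨
    length (pre ++ suf)        ∎
  where open ≤-Reasoning
shorter-left (suc n) c t pre suf = s≤s (shorter-left n c t pre suf)

shorter-right : ∀ n c pre suf → length (0 ∷ pre) ≤ length (replicate (suc n) c ++ pre ++ suf)
shorter-right zero    c pre suf = s≤s (subst (length pre ≤_) (sym (length-++ pre)) (m≤m+n _ _))
shorter-right (suc n) c pre suf = m≤n⇒m≤1+n (shorter-right n c pre suf)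

left-valid : ∀ {f} ℓ {c} pre suf → Valid (suc f) (0 ∷ replicate (suc ℓ) c ++ pre ++ suf) →
  Valid f (replicate (suc ℓ) 0 ++ map (lower (suc (length pre))) suf)
left-valid ℓ {c} pre suf (valid (s≤s len) (_ , bnd) (_ ∷ up)) = valid
  (≤-trans (shorter-left (suc ℓ) c _ pre suf) len)
  (Bounded-left (suc ℓ) 0 pre suf bnd)
  (UpwardPairs-left (suc ℓ) _ (AllPairs-++⁻ʳ pre (AllPairs-++⁻ʳ (replicate (suc ℓ) c) up)))

right-valid : ∀ {f} ℓ {c} pre suf → Bounded 1 pre → Valid (suc f) (0 ∷ replicate (suc ℓ) c ++ pre ++ suf) →
  Valid f (0 ∷ pre)
right-valid ℓ {c} pre suf bpre (valid (s≤s len) _ (_ ∷ up)) = valid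
  (≤-trans (shorter-right ℓ c pre suf) len)
  (z≤n , bpre)
  (All.universal upward-from-0 pre ∷ AllPairs-++⁻ˡ pre (AllPairs-++⁻ʳ (replicate (suc ℓ) c) up))

colour : ℕ → Tree → Tree → Tree
colour zero    = ω
colour (suc _) = β

blackNodes-colour : ∀ c T S → blackNodes (colour c T S) ≡ ascentAt 0 c + (blackNodes T + blackNodes S)
blackNodes-colour zero    T S = refl
blackNodes-colour (suc c) T S = refl

left-argument : ∀ c xs →
  replicate (length (takeWhile (_≟ c) (c ∷ xs))) 0 ++ σneg (suc (length (front c xs))) (back c xs)
    ≡ replicate (suc (runTail c xs)) 0 ++ map (lower (suc (length (front c xs)))) (back c xs)
left-argument c xs = cong₂ (λ n ys → replicate n 0 ++ ys)
  (cong length (takeWhile-accept (_≟ c) xs refl)) (σneg-lower _ (back c xs))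

τ-unfold : ∀ f x c xs → τ' (suc f) (x ∷ c ∷ xs) ≡
  colour c (τ' f (replicate (suc (runTail c xs)) 0 ++ map (lower (suc (length (front c xs)))) (back c xs)))
           (τ' f (0 ∷ front c xs))
τ-unfold f x zero    xs = cong (λ A → ω (τ' f A) (τ' f (0 ∷ front zero xs)))    (left-argument zero xs)
τ-unfold f x (suc c) xs = cong (λ A → β (τ' f A) (τ' f (0 ∷ front (suc c) xs))) (left-argument (suc c) xs)

Correct : ℕ → Set
Correct f = ∀ e → Valid f e → ascents e ≡ blackNodes (τ' f e)

τ-step : ∀ f c xs → Correct f → Valid (suc f) (0 ∷ c ∷ xs) →
  ascents (0 ∷ c ∷ xs) ≡ blackNodes (τ' (suc f) (0 ∷ c ∷ xs))
τ-step f c xs correct v = begin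
    ascents (0 ∷ c ∷ xs)
  ≡⟨ cong (ascents ∘ (0 ∷_)) decomposition ⟩
    ascents (0 ∷ replicate (suc ℓ) c ++ pre ++ suf)
  ≡⟨ ascents-split ℓ pre suf c≤1 boundary front-bounded (splitFrom-back 0 R) upward-back ⟩
    ascentAt 0 c + (ascents left + ascents (0 ∷ pre))
  ≡⟨ cong (ascentAt 0 c +_) (cong₂ _+_ (correct left (left-valid ℓ pre suf v′))
                                        (correct (0 ∷ pre) (right-valid ℓ pre suf front-bounded v′))) ⟩
    ascentAt 0 c + (blackNodes (τ' f left) + blackNodes (τ' f (0 ∷ pre)))
  ≡⟨ blackNodes-colour c _ _ ⟨
    blackNodes (colour c (τ' f left) (τ' f (0 ∷ pre)))
  ≡⟨ cong blackNodes (τ-unfold f 0 c xs) ⟨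
    blackNodes (τ' (suc f) (0 ∷ c ∷ xs))
  ∎
  where
  open ≡-Reasoning
  ℓ : ℕ
  ℓ = runTail c xs
  R pre suf left : List ℕ
  R    = rest c xs
  pre  = front c xs
  suf  = back c xs
  left = replicate (suc ℓ) 0 ++ map (lower (suc (length pre))) suf
  decomposition : c ∷ xs ≡ replicate (suc ℓ) c ++ pre ++ suf
  decomposition = trans (run-decomposition c xs) (cong (replicate (suc ℓ) c ++_) (sym (splitFrom-++ 0 R)))
  v′ : Valid (suc f) (0 ∷ replicate (suc ℓ) c ++ pre ++ suf)
  v′ = subst (λ ys → Valid (suc f) (0 ∷ ys)) decomposition v
  c≤1 : c ≤ 1
  c≤1 = proj₁ (proj₂ (Valid.bounded v))
  boundary : Maybe.All (_≢ c) (head (pre ++ suf))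
  boundary = subst (Maybe.All (_≢ c) ∘ head) (sym (splitFrom-++ 0 R)) (all-head-dropWhile (_≟ c) (c ∷ xs))
  front-bounded : Bounded 1 pre
  front-bounded = splitFrom-front 0 R
  upward-back : UpwardPairs suf
  upward-back = AllPairs-++⁻ʳ pre (AllPairs-++⁻ʳ (0 ∷ replicate (suc ℓ) c) (Valid.upward v′))

ascents≡blackNodes : ∀ f → Correct f
ascents≡blackNodes zero    []              _                  = refl
ascents≡blackNodes zero    (_ ∷ _)         (valid () _ _)
ascents≡blackNodes (suc f) []              _                  = refl
ascents≡blackNodes (suc f) (_ ∷ [])        _                  = refl
ascents≡blackNodes (suc f) (zero ∷ c ∷ xs) v                  = τ-step f c xs (ascents≡blackNodes f) v
ascents≡blackNodes (suc f) (suc _ ∷ _ ∷ _) (valid _ (() , _) _)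

toList-Bounded : ∀ {n} k (e : Vec ℕ n) → (∀ i → lookup e i ≤ k + toℕ i) → Bounded k (toList e)
toList-Bounded k []ᵥ       _ = tt
toList-Bounded k (x ∷ᵥ xs) h =
  subst (x ≤_) (+-identityʳ k) (h fzero) ,
  toList-Bounded (suc k) xs (λ i → subst (lookup xs i ≤_) (+-suc k (toℕ i)) (h (fsuc i)))

toList-AllPairs : ∀ {n} {R : Rel ℕ 0ℓ} (xs : Vec ℕ n) →
  (∀ i j → i F.< j → R (lookup xs i) (lookup xs j)) → AllPairs R (toList xs)
toList-AllPairs []ᵥ       _ = []
toList-AllPairs (x ∷ᵥ xs) h =
  VecAll.toList⁺ (VecAll.lookup⁻ (λ k → h fzero (fsuc k) (s≤s z≤n))) ∷
  toList-AllPairs xs (λ i j i<j → h (fsuc i) (fsuc j) (s≤s i<j))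

upward-unless : ∀ x y → ¬ (0 < y × y < x) → Upward x y
upward-unless x zero    _     = inj₁ refl
upward-unless x (suc y) no021 with x ≤? suc y
... | yes x≤y = inj₂ x≤y
... | no x≰y  = ⊥-elim (no021 (s≤s z≤n , ≰⇒> x≰y))

-- With a leading 0, a pattern 0 < e_k < e_j is a 021 occurrence; avoiding 021
-- therefore makes all later pairs upward.
avoid021⇒upward : ∀ {m} (xs : Vec ℕ m) → Avoids021 (0 ∷ᵥ xs) →
  ∀ i j → i F.< j → Upward (lookup xs i) (lookup xs j)
avoid021⇒upward xs avoids i j i<j =
  upward-unless _ _ (avoids fzero (fsuc i) (fsuc j) (s≤s z≤n) (s≤s i<j))

-- Since e₁ ≤ 0 we have e = 0 · xs; then e is valid for the fuel |e| used by τ.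
proposition1 : (n : ℕ) → 1 ≤ n → (e : Vec ℕ n) → IsInvSeq e → Avoids021 e →
    ascents (toList e) ≡ blackNodes (τ (toList e))
proposition1 (suc m) _ (x ∷ᵥ xs) inv avoids with inv fzero
... | z≤n = ascents≡blackNodes (length (0 ∷ toList xs)) (0 ∷ toList xs) (valid ≤-refl
  (toList-Bounded 0 (0 ∷ᵥ xs) inv)
  (All.universal upward-from-0 _ ∷ toList-AllPairs xs (avoid021⇒upward xs avoids)))
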